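{- Let $G=(V,E)$ be a simple, complete, undirected graph on $n$ vertices with nonnegative edge weights $w$. The algorithm $\mathrm{ApproxCC}$ (described in the context) returns a Hamiltonian path of $G$ whose total weight is at least $\tfrac12$ times the maximum total weight of a Hamiltonian path in $G$; that is, it is a $1/2$-approximation for $\mathsf{PathMaxTSP}$.
   Context: $\mathsf{PathMaxTSP}$: given such a graph, find a Hamiltonian path (a simple path through all vertices) of maximum total edge weight. A cycle cover of a complete graph is a set of vertex-disjoint cycles, each of length at least 2 (a cycle of length 2 on $\{x,y\}$ uses the connection between $x$ and $y$ twice), such that every vertex lies in exactly one cycle; its weight is the sum of the weights of the edges traversed. Algorithm $\mathrm{ApproxCC}$: maintain a graph $G_k$ whose vertices ("super nodes") are vertex-disjoint paths of $G$ covering $V$; initially $G_0=G$, each vertex being a one-vertex path. While $G_k$ has more than one super node: compute a maximum-weight cycle cover of $G_k$; from each cycle remove an edge of minimum weight, leaving a sequence of super nodes $p_1,\dots,p_a$ in cycle order; set $p\gets p_1$ and for $i=2,\dots,a$, letting $u$ be the last vertex of $p$ and $v_1,\dots,v_d$ be the path $p_i$, append $v_1,\dots,v_d$ to $p$ if $w(u,v_1)>w(u,v_d)$ and append $v_d,\dots,v_1$ otherwise; the resulting path $p$ becomes a super node of $G_{k+1}$. For super nodes $(u_1,\dots,u_a)$ and $(v_1,\dots,v_b)$ of $G_{k+1}$, the edge from the first to the second has weight $w(u_a,v_1)$. When a single super node remains, output the Hamiltonian path of $G$ it represents.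
   Formalization: The edge weights w are nonnegative rationals instead of nonnegative reals. -}

module Defs where

open import Data.Nat using (ℕ; _≤_)
open import Data.Fin using (Fin)
open import Data.Bool using (if_then_else_)
open import Data.Product using (_×_; _,_; uncurry)
open import Data.List using (List; []; _∷_; map; length; foldr; concat; allFin; foldl)
open import Data.List.NonEmpty as L⁺ using (List⁺; [_]; _⁺++⁺_; toList)
open import Data.List.Relation.Unary.All using (All)
open import Data.List.Relation.Binary.Permutation.Propositional using (_↭_)
open import Data.Rational using (ℚ; 0ℚ; _+_; _≤ᵇ_) renaming (_≤_ to _≤ℚ_)

sumℚ : List ℚ → ℚ
sumℚ = foldr _+_ 0ℚ

steps : {A : Set} → List A → List (A × A)
steps []           = []
steps (x ∷ [])     = []
steps (x ∷ y ∷ r)  = (x , y) ∷ steps (y ∷ r)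

lastOf : {A : Set} → A → List A → A
lastOf x []      = x
lastOf x (y ∷ r) = lastOf y r

IsHamPath : (n : ℕ) → List (Fin n) → Set
IsHamPath n p = p ↭ allFin n

pathW : {n : ℕ} → (Fin n → Fin n → ℚ) → List (Fin n) → ℚ
pathW w p = sumℚ (map (uncurry w) (steps p))

module ApproxCCDefs {n : ℕ} (w : Fin n → Fin n → ℚ) where

  -- super node = nonempty path of G (list of vertices)
  SN : Set
  SN = List⁺ (Fin n)

  W : SN → SN → ℚ
  W p q = w (L⁺.last p) (L⁺.head q)

  closeW : List SN → ℚ
  closeW []      = 0ℚ
  closeW (x ∷ r) = W (lastOf x r) x

  cycleW : List SN → ℚ
  cycleW c = sumℚ (map (uncurry W) (steps c)) + closeW c

  IsCycleCover : List SN → List (List SN) → Set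
  IsCycleCover S C = All (λ c → 2 ≤ length c) C × (concat C ↭ S)

  coverW : List (List SN) → ℚ
  coverW C = sumℚ (map cycleW C)

  IsMaxCycleCover : List SN → List (List SN) → Set
  IsMaxCycleCover S C =
    IsCycleCover S C × (∀ C′ → IsCycleCover S C′ → coverW C′ ≤ℚ coverW C)

  -- the closing edge (last → first) of the cycle is one of minimum weight;
  -- removing it leaves the sequence p1,...,pa in cycle order
  ClosingEdgeMin : List SN → Set
  ClosingEdgeMin c = All (λ e → closeW c ≤ℚ uncurry W e) (steps c)

  appendSN : SN → SN → SN
  appendSN p q =
    if w (L⁺.last p) (L⁺.head q) ≤ᵇ w (L⁺.last p) (L⁺.last q)
    then p ⁺++⁺ L⁺.reverse q
    else p ⁺++⁺ q

  mergeCycles : List (List SN) → List SN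
  mergeCycles []             = []
  mergeCycles ([] ∷ C)       = mergeCycles C
  mergeCycles ((p ∷ ps) ∷ C) = foldl appendSN p ps ∷ mergeCycles C

  -- Run S out : some execution of the while loop of ApproxCC, started from
  -- the super-node set S, terminates with output path `out`.
  -- (All choices of maximum cycle cover / minimum edge are allowed.)
  data Run : List SN → List (Fin n) → Set where
    done : (p : SN) → Run (p ∷ []) (toList p)
    step : (S : List SN) (C : List (List SN)) {out : List (Fin n)} →
           2 ≤ length S →
           IsMaxCycleCover S C →
           All ClosingEdgeMin C →
           Run (mergeCycles C) out →
           Run S out

initialSN : (n : ℕ) → List (List⁺ (Fin n))
initialSN n = map [_] (allFin n)

ApproxCC : {n : ℕ} → (Fin n → Fin n → ℚ) → List (Fin n) → Set
ApproxCC {n} w out = ApproxCCDefs.Run w (initialSN n) out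

{-# OPTIONS --safe #-}

-- Only the first round needs an analysis. Its super nodes are single vertices, so a Hamiltonian
-- path q, closed by a nonnegative edge, is one of the cycle covers and the maximum cycle cover C
-- weighs at least w(q). Deleting a minimum edge of a cycle on k ≥ 2 vertices loses at most half
-- of it, since that edge is at most the first edge of the remaining path; so the paths of round
-- one weigh at least w(C)/2. Later rounds never lose weight: concatenating vertex-disjoint paths
-- only adds nonnegative edges, and reversing a path keeps its weight because w is symmetric.
-- An execution exists because cycle covers of a finite set can be enumerated (as splittings of
-- its permutations), a cycle can be rotated to close on its minimum edge, and each round at
-- least halves the number of super nodes.
module Submission where

open import Defs
open import Algebra.Bundles using (CommutativeMonoid)
open import Data.Nat using (ℕ; zero; suc; s≤s; z≤n; _<_) renaming (_≤_ to _≤ℕ_; _≤?_ to _≤ℕ?_)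
import Data.Nat.Properties as ℕ
open import Data.Fin using (Fin)
open import Data.Product using (_×_; ∃; _,_; proj₁; proj₂; uncurry)
open import Data.Sum using (_⊎_; inj₁; inj₂)
open import Data.Bool using (true; false)
open import Data.List using (List; []; _∷_; _++_; _∷ʳ_; _ʳ++_; map; concat; concatMap; length; reverse; foldl; filter; allFin)
import Data.List.Properties as List
open import Data.List.NonEmpty as List⁺ using (List⁺; [_]; toList)
open import Data.List.Relation.Unary.All as All using (All; []; _∷_)
import Data.List.Relation.Unary.All.Properties as All
open import Data.List.Relation.Unary.Any using (here; there)
open import Data.List.Relation.Unary.AllPairs using ([]; _∷_)
open import Data.List.Relation.Unary.Unique.Propositional using (Unique)
import Data.List.Relation.Unary.Unique.Propositional.Properties as Unique
open import Data.List.Membership.Propositional using (_∈_)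
open import Data.List.Membership.Propositional.Properties
open import Data.List.Relation.Binary.Permutation.Propositional as ↭ using (_↭_; ↭-refl; ↭-sym; ↭-trans; ↭-reflexive; ↭⇒↭ₛ)
import Data.List.Relation.Binary.Permutation.Propositional.Properties as ↭
import Data.List.Relation.Binary.Permutation.Setoid.Properties as ↭ₛ
open import Data.Rational using (ℚ; 0ℚ; ½; _*_; _+_; _≤_; _≤ᵇ_)
import Data.Rational.Properties as ℚ
open import Algebra.Properties.CommutativeSemigroup (CommutativeMonoid.commutativeSemigroup ℚ.+-0-commutativeMonoid)
  using (interchange)
open import Data.Vec as Vec using (Vec)
import Data.Vec.Properties as Vec
open import Function using (flip; _∘_)
open import Relation.Unary using (Decidable)
open import Relation.Binary.Bundles using (DecTotalOrder)
open import Relation.Binary.PropositionalEquality using (_≡_; _≢_; refl; sym; trans; cong; cong₂; subst; setoid; module ≡-Reasoning)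

sumℚ-++ : ∀ xs ys → sumℚ (xs ++ ys) ≡ sumℚ xs + sumℚ ys
sumℚ-++ []       ys = sym (ℚ.+-identityˡ _)
sumℚ-++ (x ∷ xs) ys = trans (cong (x +_) (sumℚ-++ xs ys)) (sym (ℚ.+-assoc x _ _))

sumℚ-↭ : ∀ {xs ys} → xs ↭ ys → sumℚ xs ≡ sumℚ ys
sumℚ-↭ p = ↭ₛ.foldr-commMonoid ℚ-+-0.setoid ℚ-+-0.isCommutativeMonoid (↭⇒↭ₛ p)
  where module ℚ-+-0 = CommutativeMonoid ℚ.+-0-commutativeMonoid

module _ {A : Set} where

  sumℚ-map-cong : ∀ (f g : A → ℚ) {xs} → All (λ x → f x ≡ g x) xs → sumℚ (map f xs) ≡ sumℚ (map g xs)
  sumℚ-map-cong f g []       = refl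
  sumℚ-map-cong f g (e ∷ es) = cong₂ _+_ e (sumℚ-map-cong f g es)

  sumℚ-map-nonNeg : ∀ (f : A → ℚ) {xs} → All (λ x → 0ℚ ≤ f x) xs → 0ℚ ≤ sumℚ (map f xs)
  sumℚ-map-nonNeg f []       = ℚ.≤-refl
  sumℚ-map-nonNeg f (e ∷ es) = ℚ.+-mono-≤ e (sumℚ-map-nonNeg f es)

p≤p+q : ∀ p {q} → 0ℚ ≤ q → p ≤ p + q
p≤p+q p {q} 0≤q = subst (_≤ p + q) (ℚ.+-identityʳ p) (ℚ.+-monoʳ-≤ p 0≤q)

½*[x+x]≡x : ∀ x → ½ * (x + x) ≡ x
½*[x+x]≡x x = trans (ℚ.*-distribˡ-+ ½ x x) (trans (sym (ℚ.*-distribʳ-+ x ½ ½)) (ℚ.*-identityˡ x))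

module _ {A : Set} where

  walkW : (A → A → ℚ) → List A → ℚ
  walkW f l = sumℚ (map (uncurry f) (steps l))

  lastOf-∈ : ∀ (x : A) xs → lastOf x xs ∈ x ∷ xs
  lastOf-∈ x []       = here refl
  lastOf-∈ x (y ∷ xs) = there (lastOf-∈ y xs)

  lastOf-∷ʳ : ∀ (x : A) xs y → lastOf x (xs ∷ʳ y) ≡ y
  lastOf-∷ʳ x []       y = refl
  lastOf-∷ʳ x (z ∷ xs) y = lastOf-∷ʳ z xs y

  steps-++ : ∀ (x : A) xs y ys →
             steps ((x ∷ xs) ++ (y ∷ ys)) ≡ steps (x ∷ xs) ++ (lastOf x xs , y) ∷ steps (y ∷ ys)
  steps-++ x []        y ys = refl
  steps-++ x (x′ ∷ xs) y ys = cong ((x , x′) ∷_) (steps-++ x′ xs y ys)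

  steps-∷ʳ : ∀ (x : A) xs y → steps ((x ∷ xs) ∷ʳ y) ≡ steps (x ∷ xs) ∷ʳ (lastOf x xs , y)
  steps-∷ʳ x xs y = steps-++ x xs y []

  walkW-length≡1 : ∀ f (l : List A) → length l ≡ 1 → walkW f l ≡ 0ℚ
  walkW-length≡1 f (x ∷ []) _ = refl

  walkW-++ : ∀ f (x : A) xs y ys →
             walkW f ((x ∷ xs) ++ (y ∷ ys)) ≡ walkW f (x ∷ xs) + (f (lastOf x xs) y + walkW f (y ∷ ys))
  walkW-++ f x xs y ys = begin
    sumℚ (map (uncurry f) (steps ((x ∷ xs) ++ (y ∷ ys))))
      ≡⟨ cong (λ l → sumℚ (map (uncurry f) l)) (steps-++ x xs y ys) ⟩
    sumℚ (map (uncurry f) (steps (x ∷ xs) ++ (lastOf x xs , y) ∷ steps (y ∷ ys)))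
      ≡⟨ cong sumℚ (List.map-++ (uncurry f) (steps (x ∷ xs)) _) ⟩
    sumℚ (map (uncurry f) (steps (x ∷ xs)) ++ map (uncurry f) ((lastOf x xs , y) ∷ steps (y ∷ ys)))
      ≡⟨ sumℚ-++ (map (uncurry f) (steps (x ∷ xs))) _ ⟩
    walkW f (x ∷ xs) + (f (lastOf x xs) y + walkW f (y ∷ ys)) ∎
    where open ≡-Reasoning

  walkW-ʳ++ : ∀ f (xs : List A) y ys → walkW f (xs ʳ++ (y ∷ ys)) ≡ walkW (flip f) (y ∷ xs) + walkW f (y ∷ ys)
  walkW-ʳ++ f []       y ys = sym (ℚ.+-identityˡ _)
  walkW-ʳ++ f (x ∷ xs) y ys = begin
    walkW f (xs ʳ++ (x ∷ y ∷ ys))                             ≡⟨ walkW-ʳ++ f xs x (y ∷ ys) ⟩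
    walkW (flip f) (x ∷ xs) + (f x y + walkW f (y ∷ ys))      ≡⟨ ℚ.+-assoc (walkW (flip f) (x ∷ xs)) _ _ ⟨
    (walkW (flip f) (x ∷ xs) + f x y) + walkW f (y ∷ ys)      ≡⟨ cong (_+ walkW f (y ∷ ys)) (ℚ.+-comm _ (f x y)) ⟩
    walkW (flip f) (y ∷ x ∷ xs) + walkW f (y ∷ ys)            ∎
    where open ≡-Reasoning

  walkW-reverse : ∀ f (xs : List A) → walkW f (reverse xs) ≡ walkW (flip f) xs
  walkW-reverse f []       = refl
  walkW-reverse f (x ∷ xs) = trans (walkW-ʳ++ f xs x []) (ℚ.+-identityʳ _)

  Unique⇒steps-≢ : ∀ {l : List A} → Unique l → All (uncurry _≢_) (steps l)
  Unique⇒steps-≢ {[]}        _                = []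
  Unique⇒steps-≢ {x ∷ []}    _                = []
  Unique⇒steps-≢ {x ∷ y ∷ l} ((x≢y ∷ _) ∷ u) = x≢y ∷ Unique⇒steps-≢ u

  walkW-cong-≢ : ∀ {f g} → (∀ x y → x ≢ y → f x y ≡ g x y) →
                 ∀ {l} → Unique l → walkW f l ≡ walkW g l
  walkW-cong-≢ f≡g u = sumℚ-map-cong _ _ (All.map (λ {(x , y)} → f≡g x y) (Unique⇒steps-≢ u))

  walkW-nonNeg : ∀ {f} → (∀ x y → x ≢ y → 0ℚ ≤ f x y) →
                 ∀ {l} → Unique l → 0ℚ ≤ walkW f l
  walkW-nonNeg f≥0 u = sumℚ-map-nonNeg _ (All.map (λ {(x , y)} → f≥0 x y) (Unique⇒steps-≢ u))

module _ {A : Set} where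

  Unique-resp-↭ : ∀ {xs ys : List A} → xs ↭ ys → Unique xs → Unique ys
  Unique-resp-↭ p = ↭ₛ.Unique-resp-↭ (setoid A) (↭⇒↭ₛ p)

  Unique-++⁻ˡ : ∀ (xs : List A) {ys} → Unique (xs ++ ys) → Unique xs
  Unique-++⁻ˡ []       u       = []
  Unique-++⁻ˡ (x ∷ xs) (a ∷ u) = All.++⁻ˡ xs a ∷ Unique-++⁻ˡ xs u

  Unique-++⁻ʳ : ∀ (xs : List A) {ys} → Unique (xs ++ ys) → Unique ys
  Unique-++⁻ʳ []       u       = u
  Unique-++⁻ʳ (x ∷ xs) (_ ∷ u) = Unique-++⁻ʳ xs u

  Unique-++⇒≢ : ∀ (xs : List A) {ys a b} → Unique (xs ++ ys) → a ∈ xs → b ∈ ys → a ≢ b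
  Unique-++⇒≢ (x ∷ xs) (a ∷ u) (here refl) b∈ = All.lookup (All.++⁻ʳ xs a) b∈
  Unique-++⇒≢ (x ∷ xs) (a ∷ u) (there a∈)  b∈ = Unique-++⇒≢ xs u a∈ b∈

  concat-↭ : ∀ {xss yss : List (List A)} → xss ↭ yss → concat xss ↭ concat yss
  concat-↭ ↭.refl          = ↭-refl
  concat-↭ (↭.prep xs p)   = ↭.++⁺ˡ xs (concat-↭ p)
  concat-↭ (↭.swap xs ys p) = ↭-trans (↭.++⁺ˡ xs (↭.++⁺ˡ ys (concat-↭ p))) (↭.shifts xs ys)
  concat-↭ (↭.trans p q)   = ↭-trans (concat-↭ p) (concat-↭ q)

  NonEmptyBlocks : List (List A) → Set
  NonEmptyBlocks = All (λ b → 1 ≤ℕ length b)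

  LongBlocks : List (List A) → Set
  LongBlocks = All (λ b → 2 ≤ℕ length b)

  LongBlocks? : Decidable LongBlocks
  LongBlocks? = All.all? (λ b → 2 ≤ℕ? length b)

  LongBlocks⇒NonEmptyBlocks : ∀ {D} → LongBlocks D → NonEmptyBlocks D
  LongBlocks⇒NonEmptyBlocks = All.map (ℕ.≤-trans (s≤s z≤n))

  length≤length-concat : ∀ (D : List (List A)) → NonEmptyBlocks D → length D ≤ℕ length (concat D)
  length≤length-concat []      []         = z≤n
  length≤length-concat (b ∷ D) (1≤b ∷ ne) =
    subst (suc (length D) ≤ℕ_) (sym (List.length-++ b)) (ℕ.+-mono-≤ 1≤b (length≤length-concat D ne))

  length<length-concat : ∀ b (D : List (List A)) → 2 ≤ℕ length b → NonEmptyBlocks D →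
                         length (b ∷ D) < length (concat (b ∷ D))
  length<length-concat b D 2≤b ne =
    subst (suc (length (b ∷ D)) ≤ℕ_) (sym (List.length-++ b)) (ℕ.+-mono-≤ 2≤b (length≤length-concat D ne))

  toList-fromVec : ∀ {m} (v : Vec A (suc m)) → toList (List⁺.fromVec v) ≡ Vec.toList v
  toList-fromVec (x Vec.∷ xs) = refl

  toList-reverse : ∀ (q : List⁺ A) → toList (List⁺.reverse q) ≡ reverse (toList q)
  toList-reverse (x List⁺.∷ xs) = begin
    toList (List⁺.fromVec (Vec.reverse (x Vec.∷ Vec.fromList xs)))  ≡⟨ toList-fromVec (Vec.reverse (x Vec.∷ Vec.fromList xs)) ⟩
    Vec.toList (Vec.reverse (x Vec.∷ Vec.fromList xs))  ≡⟨ Vec.toList-reverse (x Vec.∷ Vec.fromList xs) ⟩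
    reverse (x ∷ Vec.toList (Vec.fromList xs))         ≡⟨ cong (λ l → reverse (x ∷ l)) (Vec.toList∘fromList xs) ⟩
    reverse (x ∷ xs)                                  ∎
    where open ≡-Reasoning

module _ {A : Set} (f : A → ℚ) where
  open import Data.List.Extrema (DecTotalOrder.totalOrder ℚ.≤-decTotalOrder)

  ∃-minimiser : ∀ {y} (L : List A) → y ∈ L → ∃ λ m → m ∈ L × All (λ z → f m ≤ f z) L
  ∃-minimiser (x ∷ xs) _ = argmin f x xs , argmin∈ , f[argmin]≤f[⊤] {f = f} x xs ∷ f[argmin]≤f[xs] {f = f} x xs
    where
    argmin∈ : argmin f x xs ∈ x ∷ xs
    argmin∈ with argmin-sel f x xs
    ... | inj₁ eq = here eq
    ... | inj₂ m∈ = there m∈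

  ∃-maximiser : ∀ {y} (L : List A) → y ∈ L → ∃ λ m → m ∈ L × All (λ z → f z ≤ f m) L
  ∃-maximiser (x ∷ xs) _ = argmax f x xs , argmax∈ , f[⊥]≤f[argmax] {f = f} x xs ∷ f[xs]≤f[argmax] {f = f} x xs
    where
    argmax∈ : argmax f x xs ∈ x ∷ xs
    argmax∈ with argmax-sel f x xs
    ... | inj₁ eq = here eq
    ... | inj₂ m∈ = there m∈

-- Enumerating permutations and splittings

module _ {A : Set} where

  insertions : A → List A → List (List A)
  insertions x []       = (x ∷ []) ∷ []
  insertions x (y ∷ ys) = (x ∷ y ∷ ys) ∷ map (y ∷_) (insertions x ys)

  permutations : List A → List (List A)
  permutations []       = [] ∷ []
  permutations (x ∷ xs) = concatMap (insertions x) (permutations xs)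

  insertions-sound : ∀ {x ys l} → l ∈ insertions x ys → l ↭ x ∷ ys
  insertions-sound {ys = []}     (here refl) = ↭-refl
  insertions-sound {ys = y ∷ ys} (here refl) = ↭-refl
  insertions-sound {ys = y ∷ ys} (there l∈) with ∈-map⁻ (y ∷_) l∈
  ... | l′ , l′∈ , refl = ↭-trans (↭.prep y (insertions-sound l′∈)) (↭.swap y _ ↭-refl)

  insertions-complete : ∀ x ys zs → ys ++ x ∷ zs ∈ insertions x (ys ++ zs)
  insertions-complete x []       []       = here refl
  insertions-complete x []       (z ∷ zs) = here refl
  insertions-complete x (y ∷ ys) zs       = there (∈-map⁺ (y ∷_) (insertions-complete x ys zs))

  permutations-sound : ∀ {xs l} → l ∈ permutations xs → l ↭ xs
  permutations-sound {[]}     (here refl) = ↭-refl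
  permutations-sound {x ∷ xs} l∈ with ∈-concat⁻′ (map (insertions x) (permutations xs)) l∈
  ... | L , l∈L , L∈ with ∈-map⁻ (insertions x) L∈
  ... | l′ , l′∈ , refl = ↭-trans (insertions-sound l∈L) (↭.prep x (permutations-sound l′∈))

  permutations-complete : ∀ xs {l} → l ↭ xs → l ∈ permutations xs
  permutations-complete []       p rewrite ↭.↭-empty-inv p = here refl
  permutations-complete (x ∷ xs) p with ∈-∃++ (↭.∈-resp-↭ (↭-sym p) (here refl))
  ... | ys , zs , refl = ∈-concat⁺′ (insertions-complete x ys zs)
                           (∈-map⁺ (insertions x) (permutations-complete xs (↭.drop-mid ys [] p)))

  extendSplitting : A → List (List A) → List (List (List A))
  extendSplitting x []      = ((x ∷ []) ∷ []) ∷ []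
  extendSplitting x (b ∷ D) = ((x ∷ []) ∷ b ∷ D) ∷ ((x ∷ b) ∷ D) ∷ []

  splittings : List A → List (List (List A))
  splittings []       = [] ∷ []
  splittings (x ∷ xs) = concatMap (extendSplitting x) (splittings xs)

  extendSplitting-concat : ∀ {x E D} → D ∈ extendSplitting x E → concat D ≡ x ∷ concat E
  extendSplitting-concat {E = []}    (here refl)         = refl
  extendSplitting-concat {E = b ∷ E} (here refl)         = refl
  extendSplitting-concat {E = b ∷ E} (there (here refl)) = refl

  splittings-sound : ∀ {l D} → D ∈ splittings l → concat D ≡ l
  splittings-sound {[]}     (here refl) = refl
  splittings-sound {x ∷ xs} D∈ with ∈-concat⁻′ (map (extendSplitting x) (splittings xs)) D∈
  ... | L , D∈L , L∈ with ∈-map⁻ (extendSplitting x) L∈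
  ... | E , E∈ , refl = trans (extendSplitting-concat D∈L) (cong (x ∷_) (splittings-sound E∈))

  extendSplitting-new : ∀ x E → ((x ∷ []) ∷ E) ∈ extendSplitting x E
  extendSplitting-new x []      = here refl
  extendSplitting-new x (b ∷ E) = here refl

  splittings-complete : ∀ D → NonEmptyBlocks D → D ∈ splittings (concat D)
  splittings-complete []            []       = here refl
  splittings-complete ((x ∷ b) ∷ D) (_ ∷ ne) = block-complete x b
    where
    block-complete : ∀ x b → ((x ∷ b) ∷ D) ∈ splittings (x ∷ b ++ concat D)
    block-complete x []      = ∈-concat⁺′ (extendSplitting-new x D) (∈-map⁺ (extendSplitting x) (splittings-complete D ne))
    block-complete x (y ∷ b) = ∈-concat⁺′ (there (here refl)) (∈-map⁺ (extendSplitting x) (block-complete y b))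

-- Rotations of cycles

module _ {A : Set} where

  rotate : List A → List A
  rotate []       = []
  rotate (x ∷ xs) = xs ∷ʳ x

  rotateBy : ℕ → List A → List A
  rotateBy zero    xs = xs
  rotateBy (suc k) xs = rotateBy k (rotate xs)

  rotateBy-↭ : ∀ k (xs : List A) → rotateBy k xs ↭ xs
  rotateBy-↭ zero    xs       = ↭-refl
  rotateBy-↭ (suc k) []       = rotateBy-↭ k []
  rotateBy-↭ (suc k) (x ∷ xs) = ↭-trans (rotateBy-↭ k (xs ∷ʳ x)) (↭-sym (↭.∷↭∷ʳ x xs))

  rotateBy-++ : ∀ (xs ys : List A) → rotateBy (length xs) (xs ++ ys) ≡ ys ++ xs
  rotateBy-++ []       ys = sym (List.++-identityʳ ys)
  rotateBy-++ (x ∷ xs) ys = begin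
    rotateBy (length xs) ((xs ++ ys) ∷ʳ x)  ≡⟨ cong (rotateBy (length xs)) (List.++-assoc xs ys (x ∷ [])) ⟩
    rotateBy (length xs) (xs ++ ys ∷ʳ x)    ≡⟨ rotateBy-++ xs (ys ∷ʳ x) ⟩
    (ys ∷ʳ x) ++ xs                        ≡⟨ List.++-assoc ys (x ∷ []) xs ⟩
    ys ++ x ∷ xs                           ∎
    where open ≡-Reasoning

module _ {A : Set} where

  cycleEdges : List A → List (A × A)
  cycleEdges []       = []
  cycleEdges (x ∷ xs) = steps ((x ∷ xs) ∷ʳ x)

  cycleEdges-rotate : ∀ xs → cycleEdges (rotate xs) ≡ rotate (cycleEdges xs)
  cycleEdges-rotate []           = refl
  cycleEdges-rotate (x ∷ [])     = refl
  cycleEdges-rotate (x ∷ y ∷ xs) = trans (steps-∷ʳ y (xs ∷ʳ x) y)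
    (cong (λ z → steps (y ∷ xs ∷ʳ x) ∷ʳ (z , y)) (lastOf-∷ʳ y xs x))

  cycleEdges-rotateBy : ∀ k xs → cycleEdges (rotateBy k xs) ≡ rotateBy k (cycleEdges xs)
  cycleEdges-rotateBy zero    xs = refl
  cycleEdges-rotateBy (suc k) xs = trans (cycleEdges-rotateBy k (rotate xs)) (cong (rotateBy k) (cycleEdges-rotate xs))

-- Every execution of ApproxCC can be continued until it terminates

module Execution {n : ℕ} (w : Fin n → Fin n → ℚ) where
  open ApproxCCDefs w

  cycleW-cycleEdges : ∀ c → cycleW c ≡ sumℚ (map (uncurry W) (cycleEdges c))
  cycleW-cycleEdges []       = ℚ.+-identityʳ 0ℚ
  cycleW-cycleEdges (x ∷ xs) = sym (begin
    sumℚ (map (uncurry W) (steps ((x ∷ xs) ∷ʳ x)))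
      ≡⟨ cong (λ l → sumℚ (map (uncurry W) l)) (steps-∷ʳ x xs x) ⟩
    sumℚ (map (uncurry W) (steps (x ∷ xs) ∷ʳ (lastOf x xs , x)))
      ≡⟨ cong sumℚ (List.map-++ (uncurry W) (steps (x ∷ xs)) _) ⟩
    sumℚ (map (uncurry W) (steps (x ∷ xs)) ∷ʳ W (lastOf x xs) x)
      ≡⟨ sumℚ-++ (map (uncurry W) (steps (x ∷ xs))) _ ⟩
    walkW W (x ∷ xs) + (W (lastOf x xs) x + 0ℚ)
      ≡⟨ cong (walkW W (x ∷ xs) +_) (ℚ.+-identityʳ _) ⟩
    cycleW (x ∷ xs) ∎)
    where open ≡-Reasoning

  cycleW-rotateBy : ∀ k c → cycleW (rotateBy k c) ≡ cycleW c
  cycleW-rotateBy k c = begin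
    cycleW (rotateBy k c)                                     ≡⟨ cycleW-cycleEdges (rotateBy k c) ⟩
    sumℚ (map (uncurry W) (cycleEdges (rotateBy k c)))        ≡⟨ cong (λ l → sumℚ (map (uncurry W) l)) (cycleEdges-rotateBy k c) ⟩
    sumℚ (map (uncurry W) (rotateBy k (cycleEdges c)))        ≡⟨ sumℚ-↭ (↭.map⁺ (uncurry W) (rotateBy-↭ k (cycleEdges c))) ⟩
    sumℚ (map (uncurry W) (cycleEdges c))                     ≡⟨ cycleW-cycleEdges c ⟨
    cycleW c                                                  ∎
    where open ≡-Reasoning

  cycleEdges≡∷ʳ⇒closing : ∀ c {L e} → cycleEdges c ≡ L ∷ʳ e → steps c ≡ L × closeW c ≡ uncurry W e
  cycleEdges≡∷ʳ⇒closing []       {[]}    ()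
  cycleEdges≡∷ʳ⇒closing []       {_ ∷ _} ()
  cycleEdges≡∷ʳ⇒closing (x ∷ xs) {L}     eq =
    let steps≡ , closing≡ = List.∷ʳ-injective (steps (x ∷ xs)) L (trans (sym (steps-∷ʳ x xs x)) eq)
    in steps≡ , cong (uncurry W) closing≡

  -- rotating the cycle until the edge m comes last makes m the closing edge
  rotateBy-ClosingEdgeMin : ∀ c a m b → cycleEdges c ≡ a ++ m ∷ b →
                            All (λ e → uncurry W m ≤ uncurry W e) (cycleEdges c) →
                            ClosingEdgeMin (rotateBy (length (a ∷ʳ m)) c)
  rotateBy-ClosingEdgeMin c a m b split m≤ =
    subst (All _) (sym steps≡) (All.map (subst (_≤ _) (sym closing≡)) (All.++⁺ m≤b m≤a))
    where
    Wm≤W : SN × SN → Set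
    Wm≤W e = uncurry W m ≤ uncurry W e
    m≤a+m≤b : All Wm≤W a × All Wm≤W (m ∷ b)
    m≤a+m≤b = All.++⁻ a (subst (All Wm≤W) split m≤)
    m≤a : All Wm≤W a
    m≤a = proj₁ m≤a+m≤b
    m≤b : All Wm≤W b
    m≤b = All.++⁻ʳ (m ∷ []) (proj₂ m≤a+m≤b)
    edges≡ : cycleEdges (rotateBy (length (a ∷ʳ m)) c) ≡ (b ++ a) ∷ʳ m
    edges≡ = begin
      cycleEdges (rotateBy (length (a ∷ʳ m)) c)        ≡⟨ cycleEdges-rotateBy (length (a ∷ʳ m)) c ⟩
      rotateBy (length (a ∷ʳ m)) (cycleEdges c)        ≡⟨ cong (rotateBy (length (a ∷ʳ m))) (trans split (sym (List.++-assoc a (m ∷ []) b))) ⟩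
      rotateBy (length (a ∷ʳ m)) ((a ∷ʳ m) ++ b)       ≡⟨ rotateBy-++ (a ∷ʳ m) b ⟩
      b ++ a ∷ʳ m                                     ≡⟨ List.++-assoc b a (m ∷ []) ⟨
      (b ++ a) ∷ʳ m                                   ∎
      where open ≡-Reasoning
    steps≡ : steps (rotateBy (length (a ∷ʳ m)) c) ≡ b ++ a
    steps≡ = proj₁ (cycleEdges≡∷ʳ⇒closing (rotateBy (length (a ∷ʳ m)) c) edges≡)
    closing≡ : closeW (rotateBy (length (a ∷ʳ m)) c) ≡ uncurry W m
    closing≡ = proj₂ (cycleEdges≡∷ʳ⇒closing (rotateBy (length (a ∷ʳ m)) c) edges≡)

  ∃-rotation-ClosingEdgeMin : ∀ x xs → ∃ λ d → d ↭ x ∷ xs × ClosingEdgeMin d × cycleW d ≡ cycleW (x ∷ xs)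
  ∃-rotation-ClosingEdgeMin x xs =
    let m , m∈ , m≤ = ∃-minimiser (uncurry W) (cycleEdges (x ∷ xs)) closing∈
        a , b , split = ∈-∃++ m∈
        k = length (a ∷ʳ m)
    in rotateBy k (x ∷ xs) , rotateBy-↭ k (x ∷ xs) , rotateBy-ClosingEdgeMin (x ∷ xs) a m b split m≤ ,
       cycleW-rotateBy k (x ∷ xs)
    where
    closing∈ : (lastOf x xs , x) ∈ cycleEdges (x ∷ xs)
    closing∈ = subst ((lastOf x xs , x) ∈_) (sym (steps-∷ʳ x xs x)) (∈-++⁺ʳ (steps (x ∷ xs)) (here refl))

  rotateCycles : ∀ C → LongBlocks C → ∃ λ C′ →
                 concat C′ ↭ concat C × LongBlocks C′ × All ClosingEdgeMin C′ × coverW C′ ≡ coverW C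
  rotateCycles []             []         = [] , ↭-refl , [] , [] , refl
  rotateCycles ((x ∷ xs) ∷ C) (2≤c ∷ ls) =
    let d , d↭c , closing , d≡c = ∃-rotation-ClosingEdgeMin x xs
        C′ , C′↭C , ls′ , closings , C′≡C = rotateCycles C ls
    in d ∷ C′ , ↭.++⁺ d↭c C′↭C , subst (2 ≤ℕ_) (sym (↭.↭-length d↭c)) 2≤c ∷ ls′ ,
       closing ∷ closings , cong₂ _+_ d≡c C′≡C

  -- every cycle cover is a splitting of a permutation of S into long blocks
  cycleCoverCandidates : List SN → List (List (List SN))
  cycleCoverCandidates S = filter LongBlocks? (concatMap splittings (permutations S))

  IsCycleCover⇒∈candidates : ∀ {S C} → IsCycleCover S C → C ∈ cycleCoverCandidates S
  IsCycleCover⇒∈candidates {S} {C} (long , C↭S) = ∈-filter⁺ LongBlocks?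
    (∈-concat⁺′ (splittings-complete C (LongBlocks⇒NonEmptyBlocks long)) (∈-map⁺ splittings (permutations-complete S C↭S))) long

  ∈candidates⇒IsCycleCover : ∀ {S C} → C ∈ cycleCoverCandidates S → IsCycleCover S C
  ∈candidates⇒IsCycleCover {S} {C} C∈ =
    let C∈′ , long = ∈-filter⁻ LongBlocks? C∈
        L , C∈L , L∈ = ∈-concat⁻′ (map splittings (permutations S)) C∈′
        l , l∈ , L≡ = ∈-map⁻ splittings L∈
    in long , subst (_↭ S) (sym (splittings-sound (subst (C ∈_) L≡ C∈L))) (permutations-sound l∈)

  ∃-MaxCycleCover : ∀ S → 2 ≤ℕ length S → ∃ λ C → IsMaxCycleCover S C
  ∃-MaxCycleCover S 2≤S =
    let C , C∈ , C-max = ∃-maximiser coverW (cycleCoverCandidates S) (IsCycleCover⇒∈candidates trivialCover)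
    in C , ∈candidates⇒IsCycleCover C∈ , λ C′ C′-cover → All.lookup C-max (IsCycleCover⇒∈candidates C′-cover)
    where
    trivialCover : IsCycleCover S (S ∷ [])
    trivialCover = 2≤S ∷ [] , ↭-reflexive (List.++-identityʳ S)

  ∃-MaxCycleCover-ClosingEdgeMin : ∀ S → 2 ≤ℕ length S → ∃ λ C → IsMaxCycleCover S C × All ClosingEdgeMin C
  ∃-MaxCycleCover-ClosingEdgeMin S 2≤S =
    let C , (long , C↭S) , C-max = ∃-MaxCycleCover S 2≤S
        C′ , C′↭C , long′ , closings , C′≡C = rotateCycles C long
    in C′ , ((long′ , ↭-trans C′↭C C↭S) , λ C″ C″-cover → subst (coverW C″ ≤_) (sym C′≡C) (C-max C″ C″-cover)) ,
       closings

  length-mergeCycles : ∀ C → NonEmptyBlocks C → length (mergeCycles C) ≡ length C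
  length-mergeCycles []             []       = refl
  length-mergeCycles ((p ∷ ps) ∷ C) (_ ∷ ne) = cong suc (length-mergeCycles C ne)

  mergeCycles-shrinks : ∀ {S C} → IsCycleCover S C → 1 ≤ℕ length S →
                        1 ≤ℕ length (mergeCycles C) × length (mergeCycles C) < length S
  mergeCycles-shrinks {C = []} (_ , []↭S) 1≤S with () ← ℕ.≤⇒≯ 1≤S (subst (_< 1) (↭.↭-length []↭S) (s≤s z≤n))
  mergeCycles-shrinks {S} {C = c ∷ C} (2≤c ∷ long , C↭S) _ =
    subst (1 ≤ℕ_) (sym |merge|≡) (s≤s z≤n) ,
    subst (λ k → k < length S) (sym |merge|≡)
      (subst (length (c ∷ C) <_) (↭.↭-length C↭S) (length<length-concat c C 2≤c (LongBlocks⇒NonEmptyBlocks long)))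
    where
    |merge|≡ : length (mergeCycles (c ∷ C)) ≡ length (c ∷ C)
    |merge|≡ = length-mergeCycles (c ∷ C) (LongBlocks⇒NonEmptyBlocks (2≤c ∷ long))

  ∃-Run : ∀ k S → length S ≤ℕ k → 1 ≤ℕ length S → ∃ λ out → Run S out
  ∃-Run k       (p ∷ [])     _            _ = toList p , done p
  ∃-Run (suc k) (p ∷ q ∷ S) (s≤s |S|≤k) 1≤S =
    let C , C-max , closings = ∃-MaxCycleCover-ClosingEdgeMin (p ∷ q ∷ S) 2≤S
        1≤merge , merge<S = mergeCycles-shrinks (proj₁ C-max) 1≤S
        out , run = ∃-Run k (mergeCycles C) (ℕ.≤-trans (ℕ.≤-pred merge<S) |S|≤k) 1≤merge
    in out , step (p ∷ q ∷ S) C 2≤S C-max closings run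
    where
    2≤S : 2 ≤ℕ length (p ∷ q ∷ S)
    2≤S = s≤s (s≤s z≤n)

-- Merging super nodes never loses weight

module Analysis {n : ℕ} (w : Fin n → Fin n → ℚ)
                (w-sym : ∀ x y → x ≢ y → w x y ≡ w y x)
                (w≥0 : ∀ x y → x ≢ y → 0ℚ ≤ w x y) where
  open ApproxCCDefs w

  flat : List SN → List (Fin n)
  flat S = concat (map toList S)

  totalW : List SN → ℚ
  totalW S = sumℚ (map (λ p → pathW w (toList p)) S)

  flat-++ : ∀ S S′ → flat (S ++ S′) ≡ flat S ++ flat S′
  flat-++ S S′ = trans (cong concat (List.map-++ toList S S′)) (sym (List.concat-++ (map toList S) _))

  flat-↭ : ∀ {S S′} → S ↭ S′ → flat S ↭ flat S′
  flat-↭ S↭S′ = concat-↭ (↭.map⁺ toList S↭S′)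

  totalW-++ : ∀ S S′ → totalW (S ++ S′) ≡ totalW S + totalW S′
  totalW-++ S S′ = trans (cong sumℚ (List.map-++ _ S S′)) (sumℚ-++ (map (λ p → pathW w (toList p)) S) _)

  totalW-↭ : ∀ {S S′} → S ↭ S′ → totalW S ≡ totalW S′
  totalW-↭ S↭S′ = sumℚ-↭ (↭.map⁺ _ S↭S′)

  pathW-nonNeg : ∀ {l} → Unique l → 0ℚ ≤ pathW w l
  pathW-nonNeg = walkW-nonNeg w≥0

  pathW-reverse : ∀ {l} → Unique l → pathW w (reverse l) ≡ pathW w l
  pathW-reverse {l} u = trans (walkW-reverse w l) (walkW-cong-≢ (λ x y x≢y → w-sym y x (x≢y ∘ sym)) u)

  pathW-superadditive : ∀ (p : SN) r → Unique (toList p ++ r) → pathW w (toList p) + pathW w r ≤ pathW w (toList p ++ r)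
  pathW-superadditive (x List⁺.∷ xs) [] _ = ℚ.≤-reflexive (trans (ℚ.+-identityʳ _) (cong (pathW w) (sym (List.++-identityʳ (x ∷ xs)))))
  pathW-superadditive (x List⁺.∷ xs) (y ∷ ys) u = begin
    pathW w (x ∷ xs) + pathW w (y ∷ ys)                             ≤⟨ ℚ.+-monoˡ-≤ (pathW w (y ∷ ys)) (p≤p+q (pathW w (x ∷ xs)) join≥0) ⟩
    pathW w (x ∷ xs) + w (lastOf x xs) y + pathW w (y ∷ ys)         ≡⟨ ℚ.+-assoc (pathW w (x ∷ xs)) _ _ ⟩
    pathW w (x ∷ xs) + (w (lastOf x xs) y + pathW w (y ∷ ys))       ≡⟨ walkW-++ w x xs y ys ⟨
    pathW w ((x ∷ xs) ++ y ∷ ys)                                    ∎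
    where
    open ℚ.≤-Reasoning
    join≥0 : 0ℚ ≤ w (lastOf x xs) y
    join≥0 = w≥0 _ _ (Unique-++⇒≢ (x ∷ xs) u (lastOf-∈ x xs) (here refl))

  appendSN-orientation : ∀ p q → toList (appendSN p q) ≡ toList p ++ toList q
                               ⊎ toList (appendSN p q) ≡ toList p ++ reverse (toList q)
  appendSN-orientation p q with w (List⁺.last p) (List⁺.head q) ≤ᵇ w (List⁺.last p) (List⁺.last q)
  ... | true  = inj₂ (cong (toList p ++_) (toList-reverse q))
  ... | false = inj₁ refl

  appendSN-↭ : ∀ p q → toList (appendSN p q) ↭ toList p ++ toList q
  appendSN-↭ p q with appendSN-orientation p q
  ... | inj₁ eq = ↭-reflexive eq
  ... | inj₂ eq = ↭-trans (↭-reflexive eq) (↭.++⁺ˡ (toList p) (↭.↭-reverse (toList q)))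

  -- which orientation appendSN chooses is irrelevant: reversal preserves the weight of a path
  appendSN-gain : ∀ p q → Unique (toList p ++ toList q) →
                  pathW w (toList p) + pathW w (toList q) ≤ pathW w (toList (appendSN p q))
  appendSN-gain p q u with appendSN-orientation p q
  ... | inj₁ eq = subst (pathW w (toList p) + pathW w (toList q) ≤_) (cong (pathW w) (sym eq)) (pathW-superadditive p (toList q) u)
  ... | inj₂ eq = begin
    pathW w (toList p) + pathW w (toList q)            ≡⟨ cong (pathW w (toList p) +_) (pathW-reverse (Unique-++⁻ʳ (toList p) u)) ⟨
    pathW w (toList p) + pathW w (reverse (toList q))  ≤⟨ pathW-superadditive p _ u′ ⟩
    pathW w (toList p ++ reverse (toList q))           ≡⟨ cong (pathW w) eq ⟨
    pathW w (toList (appendSN p q))                    ∎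
    where
    open ℚ.≤-Reasoning
    u′ : Unique (toList p ++ reverse (toList q))
    u′ = Unique-resp-↭ (↭.++⁺ˡ (toList p) (↭-sym (↭.↭-reverse (toList q)))) u

  foldl-appendSN-↭ : ∀ p ps → toList (foldl appendSN p ps) ↭ toList p ++ flat ps
  foldl-appendSN-↭ p []       = ↭-reflexive (sym (List.++-identityʳ (toList p)))
  foldl-appendSN-↭ p (q ∷ ps) = begin
    toList (foldl appendSN (appendSN p q) ps)  ↭⟨ foldl-appendSN-↭ (appendSN p q) ps ⟩
    toList (appendSN p q) ++ flat ps           ↭⟨ ↭.++⁺ʳ (flat ps) (appendSN-↭ p q) ⟩
    (toList p ++ toList q) ++ flat ps          ≡⟨ List.++-assoc (toList p) (toList q) (flat ps) ⟩
    toList p ++ flat (q ∷ ps)                  ∎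
    where open ↭.PermutationReasoning

  foldl-appendSN-gain : ∀ p ps → Unique (toList p ++ flat ps) →
                        pathW w (toList p) + totalW ps ≤ pathW w (toList (foldl appendSN p ps))
  foldl-appendSN-gain p []       _ = ℚ.≤-reflexive (ℚ.+-identityʳ _)
  foldl-appendSN-gain p (q ∷ ps) u = begin
    pathW w (toList p) + (pathW w (toList q) + totalW ps)  ≡⟨ ℚ.+-assoc (pathW w (toList p)) _ _ ⟨
    pathW w (toList p) + pathW w (toList q) + totalW ps    ≤⟨ ℚ.+-monoˡ-≤ (totalW ps) (appendSN-gain p q (Unique-++⁻ˡ _ u′)) ⟩
    pathW w (toList (appendSN p q)) + totalW ps            ≤⟨ foldl-appendSN-gain (appendSN p q) ps u″ ⟩
    pathW w (toList (foldl appendSN (appendSN p q) ps))    ∎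
    where
    open ℚ.≤-Reasoning
    u′ : Unique ((toList p ++ toList q) ++ flat ps)
    u′ = subst Unique (sym (List.++-assoc (toList p) (toList q) (flat ps))) u
    u″ : Unique (toList (appendSN p q) ++ flat ps)
    u″ = Unique-resp-↭ (↭.++⁺ʳ (flat ps) (↭-sym (appendSN-↭ p q))) u′

  mergeCycles-↭ : ∀ C → flat (mergeCycles C) ↭ flat (concat C)
  mergeCycles-↭ []               = ↭-refl
  mergeCycles-↭ ([] ∷ C)         = mergeCycles-↭ C
  mergeCycles-↭ ((p ∷ ps) ∷ C) = begin
    toList (foldl appendSN p ps) ++ flat (mergeCycles C)  ↭⟨ ↭.++⁺ (foldl-appendSN-↭ p ps) (mergeCycles-↭ C) ⟩
    (toList p ++ flat ps) ++ flat (concat C)              ≡⟨ List.++-assoc (toList p) (flat ps) _ ⟩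
    toList p ++ flat ps ++ flat (concat C)                ≡⟨ cong (toList p ++_) (flat-++ ps (concat C)) ⟨
    flat (concat ((p ∷ ps) ∷ C))                          ∎
    where open ↭.PermutationReasoning

  mergeCycles-gain : ∀ C → Unique (flat (concat C)) → totalW (concat C) ≤ totalW (mergeCycles C)
  mergeCycles-gain []             _ = ℚ.≤-refl
  mergeCycles-gain ([] ∷ C)       u = mergeCycles-gain C u
  mergeCycles-gain ((p ∷ ps) ∷ C) u = begin
    pathW w (toList p) + totalW (ps ++ concat C)                   ≡⟨ cong (pathW w (toList p) +_) (totalW-++ ps (concat C)) ⟩
    pathW w (toList p) + (totalW ps + totalW (concat C))           ≡⟨ ℚ.+-assoc (pathW w (toList p)) _ _ ⟨
    pathW w (toList p) + totalW ps + totalW (concat C)             ≤⟨ ℚ.+-mono-≤ (foldl-appendSN-gain p ps (Unique-++⁻ˡ _ u′))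
                                                                                  (mergeCycles-gain C (Unique-++⁻ʳ (toList p ++ flat ps) u′)) ⟩
    pathW w (toList (foldl appendSN p ps)) + totalW (mergeCycles C) ∎
    where
    open ℚ.≤-Reasoning
    u′ : Unique ((toList p ++ flat ps) ++ flat (concat C))
    u′ = subst Unique (trans (cong (toList p ++_) (flat-++ ps (concat C))) (sym (List.++-assoc (toList p) _ _))) u

  Run-↭ : ∀ {S out} → Run S out → out ↭ flat S
  Run-↭ (done p)                            = ↭-reflexive (sym (List.++-identityʳ (toList p)))
  Run-↭ (step S C _ ((_ , C↭S) , _) _ run) = ↭-trans (Run-↭ run) (↭-trans (mergeCycles-↭ C) (flat-↭ C↭S))

  Run-gain : ∀ {S out} → Run S out → Unique (flat S) → totalW S ≤ pathW w out
  Run-gain (done p)                            _ = ℚ.≤-reflexive (ℚ.+-identityʳ _)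
  Run-gain {out = out} (step S C _ ((_ , C↭S) , _) _ run) u = begin
    totalW S                  ≡⟨ totalW-↭ C↭S ⟨
    totalW (concat C)         ≤⟨ mergeCycles-gain C uC ⟩
    totalW (mergeCycles C)    ≤⟨ Run-gain run (Unique-resp-↭ (↭-sym (mergeCycles-↭ C)) uC) ⟩
    pathW w out               ∎
    where
    open ℚ.≤-Reasoning
    uC : Unique (flat (concat C))
    uC = Unique-resp-↭ (flat-↭ (↭-sym C↭S)) u

  -- The first round, on one-vertex super nodes

  IsSingleton : SN → Set
  IsSingleton p = ∃ λ x → p ≡ [ x ]

  All-IsSingleton⇒≡map : ∀ c → All IsSingleton c → c ≡ map [_] (map List⁺.head c)
  All-IsSingleton⇒≡map []      []                  = refl
  All-IsSingleton⇒≡map (p ∷ c) ((x , refl) ∷ singles) = cong ([ x ] ∷_) (All-IsSingleton⇒≡map c singles)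

  flat-singletons : ∀ xs → flat (map [_] xs) ≡ xs
  flat-singletons []       = refl
  flat-singletons (x ∷ xs) = cong (x ∷_) (flat-singletons xs)

  walkW-singletons : ∀ xs → walkW W (map [_] xs) ≡ pathW w xs
  walkW-singletons []           = refl
  walkW-singletons (x ∷ [])     = refl
  walkW-singletons (x ∷ y ∷ xs) = cong (w x y +_) (walkW-singletons (y ∷ xs))

  closeW-singletons : ∀ x xs → closeW (map [_] (x ∷ xs)) ≡ w (lastOf x xs) x
  closeW-singletons x []       = refl
  closeW-singletons x (y ∷ xs) = cong (λ p → W p [ x ]) (lastOf-singletons y xs)
    where
    lastOf-singletons : ∀ y xs → lastOf [ y ] (map [_] xs) ≡ [ lastOf y xs ]
    lastOf-singletons y []       = refl
    lastOf-singletons y (z ∷ xs) = lastOf-singletons z xs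

  cycleW-singletons : ∀ x xs → cycleW (map [_] (x ∷ xs)) ≡ pathW w (x ∷ xs) + w (lastOf x xs) x
  cycleW-singletons x xs = cong₂ _+_ (walkW-singletons (x ∷ xs)) (closeW-singletons x xs)

  foldl-appendSN-singletons : ∀ p ys → toList (foldl appendSN p (map [_] ys)) ≡ toList p ++ ys
  foldl-appendSN-singletons p []       = sym (List.++-identityʳ (toList p))
  foldl-appendSN-singletons p (y ∷ ys) = begin
    toList (foldl appendSN (appendSN p [ y ]) (map [_] ys))  ≡⟨ foldl-appendSN-singletons (appendSN p [ y ]) ys ⟩
    toList (appendSN p [ y ]) ++ ys                         ≡⟨ cong (_++ ys) append≡ ⟩
    (toList p ∷ʳ y) ++ ys                                   ≡⟨ List.++-assoc (toList p) (y ∷ []) ys ⟩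
    toList p ++ y ∷ ys                                      ∎
    where
    open ≡-Reasoning
    append≡ : toList (appendSN p [ y ]) ≡ toList p ∷ʳ y
    append≡ with appendSN-orientation p [ y ]
    ... | inj₁ eq = eq
    ... | inj₂ eq = eq

  -- the closing edge is at most the first edge, which is at most the whole path
  singletonCycle-gain : ∀ x y zs → ClosingEdgeMin (map [_] (x ∷ y ∷ zs)) → Unique (x ∷ y ∷ zs) →
                        cycleW (map [_] (x ∷ y ∷ zs)) ≤ pathW w (x ∷ y ∷ zs) + pathW w (x ∷ y ∷ zs)
  singletonCycle-gain x y zs (closing≤first ∷ _) (_ ∷ u) = begin
    cycleW (map [_] (x ∷ y ∷ zs))                                 ≡⟨ cong (_+ closeW (map [_] (x ∷ y ∷ zs))) (walkW-singletons (x ∷ y ∷ zs)) ⟩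
    pathW w (x ∷ y ∷ zs) + closeW (map [_] (x ∷ y ∷ zs))          ≤⟨ ℚ.+-monoʳ-≤ (pathW w (x ∷ y ∷ zs)) closing≤path ⟩
    pathW w (x ∷ y ∷ zs) + pathW w (x ∷ y ∷ zs)                   ∎
    where
    open ℚ.≤-Reasoning
    closing≤path : closeW (map [_] (x ∷ y ∷ zs)) ≤ pathW w (x ∷ y ∷ zs)
    closing≤path = ℚ.≤-trans closing≤first (p≤p+q (w x y) (pathW-nonNeg u))

  firstRound-gain : ∀ C → All (All IsSingleton) C → LongBlocks C → All ClosingEdgeMin C →
                    Unique (flat (concat C)) → coverW C ≤ totalW (mergeCycles C) + totalW (mergeCycles C)
  firstRound-gain []      []             []           []                   _ = ℚ.≤-refl
  firstRound-gain (c ∷ C) (singles ∷ ss) (2≤c ∷ long) (closing ∷ closings) u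
    with map List⁺.head c | All-IsSingleton⇒≡map c singles
  ... | []          | refl with () ← 2≤c
  ... | x ∷ []      | refl with s≤s () ← 2≤c
  ... | x ∷ y ∷ zs | refl = begin
    cycleW c + coverW C                  ≤⟨ ℚ.+-mono-≤ (singletonCycle-gain x y zs closing (Unique-++⁻ˡ (x ∷ y ∷ zs) u′))
                                                        (firstRound-gain C ss long closings (Unique-++⁻ʳ (x ∷ y ∷ zs) u′)) ⟩
    (m + m) + (M + M)                    ≡⟨ interchange m m M M ⟩
    (m + M) + (m + M)                    ≡⟨ cong (λ l → (pathW w l + M) + (pathW w l + M)) merged≡ ⟨
    totalW (mergeCycles (c ∷ C)) + totalW (mergeCycles (c ∷ C)) ∎
    where
    open ℚ.≤-Reasoning
    m M : ℚ
    m = pathW w (x ∷ y ∷ zs)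
    M = totalW (mergeCycles C)
    merged≡ : toList (foldl appendSN [ x ] (map [_] (y ∷ zs))) ≡ x ∷ y ∷ zs
    merged≡ = foldl-appendSN-singletons [ x ] (y ∷ zs)
    u′ : Unique ((x ∷ y ∷ zs) ++ flat (concat C))
    u′ = subst Unique (trans (flat-++ c (concat C)) (cong (_++ flat (concat C)) (flat-singletons (x ∷ y ∷ zs)))) u

  hamCycle : List (Fin n) → List (List SN)
  hamCycle q = map [_] q ∷ []

  hamCycle-IsCycleCover : ∀ {q vs} → q ↭ vs → 2 ≤ℕ length q → IsCycleCover (map [_] vs) (hamCycle q)
  hamCycle-IsCycleCover {q} q↭vs 2≤q =
    subst (2 ≤ℕ_) (sym (List.length-map [_] q)) 2≤q ∷ [] ,
    ↭-trans (↭-reflexive (List.++-identityʳ (map [_] q))) (↭.map⁺ [_] q↭vs)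

  pathW≤coverW-hamCycle : ∀ q → 2 ≤ℕ length q → Unique q → pathW w q ≤ coverW (hamCycle q)
  pathW≤coverW-hamCycle (x ∷ [])     (s≤s ()) _
  pathW≤coverW-hamCycle (x ∷ y ∷ zs) _        (x∉ ∷ _) = begin
    pathW w (x ∷ y ∷ zs)                                   ≤⟨ p≤p+q (pathW w (x ∷ y ∷ zs)) closing≥0 ⟩
    pathW w (x ∷ y ∷ zs) + w (lastOf y zs) x               ≡⟨ cycleW-singletons x (y ∷ zs) ⟨
    cycleW (map [_] (x ∷ y ∷ zs))                          ≡⟨ ℚ.+-identityʳ _ ⟨
    coverW (hamCycle (x ∷ y ∷ zs))                         ∎
    where
    open ℚ.≤-Reasoning
    closing≥0 : 0ℚ ≤ w (lastOf y zs) x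
    closing≥0 = w≥0 _ _ (λ last≡x → All.lookup x∉ (lastOf-∈ y zs) (sym last≡x))

  ½-approximation : ∀ {S out} vs q → S ≡ map [_] vs → Unique vs → q ↭ vs → Run S out → ½ * pathW w q ≤ pathW w out
  ½-approximation vs q S≡ u q↭vs (done p) = begin
    ½ * pathW w q  ≡⟨ cong (½ *_) (walkW-length≡1 w q |q|≡1) ⟩
    0ℚ             ≤⟨ pathW-nonNeg (Unique-++⁻ˡ (toList p) (subst (λ S → Unique (flat S)) (sym S≡) uflat)) ⟩
    pathW w (toList p) ∎
    where
    open ℚ.≤-Reasoning
    uflat : Unique (flat (map [_] vs))
    uflat = subst Unique (sym (flat-singletons vs)) u
    |q|≡1 : length q ≡ 1
    |q|≡1 = trans (↭.↭-length q↭vs) (trans (sym (List.length-map [_] vs)) (cong length (sym S≡)))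
  ½-approximation {out = out} vs q refl u q↭vs (step _ C 2≤S ((long , C↭S) , C-max) closings run) = begin
    ½ * pathW w q                ≤⟨ ℚ.*-monoˡ-≤-nonNeg ½ (pathW≤coverW-hamCycle q 2≤q (Unique-resp-↭ (↭-sym q↭vs) u)) ⟩
    ½ * coverW (hamCycle q)      ≤⟨ ℚ.*-monoˡ-≤-nonNeg ½ (C-max (hamCycle q) (hamCycle-IsCycleCover q↭vs 2≤q)) ⟩
    ½ * coverW C                 ≤⟨ ℚ.*-monoˡ-≤-nonNeg ½ (firstRound-gain C singles long closings uC) ⟩
    ½ * (X + X)                  ≡⟨ ½*[x+x]≡x X ⟩
    X                            ≤⟨ Run-gain run (Unique-resp-↭ (↭-sym (mergeCycles-↭ C)) uC) ⟩
    pathW w out                  ∎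
    where
    open ℚ.≤-Reasoning
    X : ℚ
    X = totalW (mergeCycles C)
    2≤q : 2 ≤ℕ length q
    2≤q = subst (2 ≤ℕ_) (trans (List.length-map [_] vs) (sym (↭.↭-length q↭vs))) 2≤S
    uC : Unique (flat (concat C))
    uC = Unique-resp-↭ (flat-↭ (↭-sym C↭S)) (subst Unique (sym (flat-singletons vs)) u)
    singles : All (All IsSingleton) C
    singles = All.concat⁻ (↭.All-resp-↭ (↭-sym C↭S) (All.map⁺ (All.universal (λ x → x , refl) vs)))

theorem4p7 : (n : ℕ) → 1 ≤ℕ n →
    (w : Fin n → Fin n → ℚ) →
    (∀ x y → x ≢ y → w x y ≡ w y x) →
    (∀ x y → x ≢ y → 0ℚ ≤ w x y) →
    (∃ λ out → ApproxCC w out) ×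
    (∀ out → ApproxCC w out →
      IsHamPath n out × (∀ q → IsHamPath n q → ½ * pathW w q ≤ pathW w out))
theorem4p7 n 1≤n w w-sym w≥0 =
  ∃-Run n (initialSN n) (ℕ.≤-reflexive |V|≡n) (subst (1 ≤ℕ_) (sym |V|≡n) 1≤n) ,
  λ out run → subst (out ↭_) (flat-singletons (allFin n)) (Run-↭ run) ,
              λ q q-ham → ½-approximation (allFin n) q refl (Unique.allFin⁺ n) q-ham run
  where
  open Execution w
  open Analysis w w-sym w≥0
  |V|≡n : length (initialSN n) ≡ n
  |V|≡n = trans (List.length-map [_] (allFin n)) (List.length-tabulate (λ i → i))
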